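{- Let $P$ be a finite Eulerian Sheffer poset of rank $4$, with binomial factorial function $B$ and Sheffer factorial function $D$. Then one of the following holds: (1) $B(3)=2r$, $D(3)=4$, $D(4)=4r$ for some integer $r\geq 2$; (2) $B(3)=10$, $D(3)=6$, $D(4)=120$; (3) $B(3)=8$, $D(3)=6$, $D(4)=48$; (4) $B(3)=6$, $D(3)=6$, $D(4)=24$; (5) $B(3)=4$, $D(3)=6$, $D(4)=12$; (6) $B(3)=6$, $D(3)=10$, $D(4)=120$; (7) $B(3)=6$, $D(3)=8$, $D(4)=48$; (8) $B(3)=6$, $D(3)=4$, $D(4)=12$; (9) $B(3)=4$, $D(3)=2r$, $D(4)=4r$ for some integer $r\geq 2$.
   Context: A finite graded poset with minimum $\hat 0$ and maximum $\hat 1$ is Eulerian if every interval $[x,y]$ with $x<y$ has as many elements of even rank as of odd rank. A finite Sheffer poset is a finite poset with $\hat 0$ and $\hat 1$ in which every interval is graded, any two intervals $[\hat 0,y]$ of the same length $n$ have the same number $D(n)$ of maximal chains (Sheffer factorial function), and any two intervals $[x,y]$ of the same length $n$ with $x\neq\hat 0$ have the same number $B(n)$ of maximal chains (binomial factorial function). -}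

module Defs where

open import Data.Nat using (ℕ; zero; suc; _<_; _%_)
open import Data.Nat.Properties using () renaming (_≟_ to _≟ℕ_)
open import Data.Fin using (Fin)
open import Data.Fin.Properties using (_≟_; any?)
open import Data.List using (List; filter; map; length)
open import Data.Nat.ListAction using (sum)
open import Data.Product using (Σ; ∃; _×_; _,_)
open import Relation.Nullary using (¬_; Dec; yes; no)
open import Relation.Nullary.Decidable using (_×-dec_; ¬?)
open import Relation.Binary.PropositionalEquality using (_≡_; _≢_)
open import Relation.Binary.Core using (Rel)
open import Relation.Binary.Definitions using (Decidable)
open import Data.List using () renaming (tabulate to tab)
open import Function using (id)

allFin : (n : ℕ) → List (Fin n)
allFin n = tab id

record BoundedFinitePoset : Set₁ where
  field
    n        : ℕ
    _≼_      : Rel (Fin n) _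
    _≼?_     : Decidable _≼_
    ≼-refl   : ∀ x → x ≼ x
    ≼-antisym : ∀ {x y} → x ≼ y → y ≼ x → x ≡ y
    ≼-trans  : ∀ {x y z} → x ≼ y → y ≼ z → x ≼ z
    ⊥̂        : Fin n
    ⊤̂        : Fin n
    ⊥̂-min    : ∀ x → ⊥̂ ≼ x
    ⊤̂-max    : ∀ x → x ≼ ⊤̂

  _≺_ : Fin n → Fin n → Set
  x ≺ y = x ≼ y × x ≢ y

  _≺?_ : Decidable _≺_
  x ≺? y = (x ≼? y) ×-dec ¬? (x ≟ y)

  _⋖_ : Fin n → Fin n → Set
  x ⋖ z = x ≺ z × ¬ (∃ λ w → x ≺ w × w ≺ z)

  _⋖?_ : Decidable _⋖_
  x ⋖? z = (x ≺? z) ×-dec ¬? (any? (λ w → (x ≺? w) ×-dec (w ≺? z)))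

  -- number of saturated chains x = c₀ ⋖ c₁ ⋖ ... ⋖ c_k = y of length k
  -- (these are exactly the maximal chains of [x,y] having length k)
  chains : ℕ → Fin n → Fin n → ℕ
  chains zero    x y with x ≟ y
  ... | yes _ = 1
  ... | no  _ = 0
  chains (suc k) x y = sum (map (λ z → chains k z y) (filter (λ z → x ⋖? z) (allFin n)))

  -- [x,y] is a graded interval of length k: x ≼ y and every maximal
  -- chain of [x,y] has length k
  IsLength : Fin n → Fin n → ℕ → Set
  IsLength x y k = x ≼ y × (∀ j → j ≢ k → chains j x y ≡ 0)

  countIn : Fin n → Fin n → (P : Fin n → Set) → (∀ z → Dec (P z)) → ℕ
  countIn x y P P? = length (filter (λ z → ((x ≼? z) ×-dec (z ≼? y)) ×-dec P? z) (allFin n))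

  IsSheffer : (B D : ℕ → ℕ) → Set
  IsSheffer B D =
      (∀ x y → x ≼ y → ∃ λ k → IsLength x y k)
    × (∀ y k → IsLength ⊥̂ y k → chains k ⊥̂ y ≡ D k)
    × (∀ x y k → x ≢ ⊥̂ → IsLength x y k → chains k x y ≡ B k)

  -- Eulerian (for a poset all of whose intervals are graded): ρ is the rank
  -- function (ρ z = length of [⊥̂,z]); every interval [x,y] with x ≺ y has
  -- as many elements of even rank as of odd rank.
  IsEulerian : Set
  IsEulerian =
      (∀ z → ∃ λ k → IsLength ⊥̂ z k)
    × (∀ (ρ : Fin n → ℕ) → (∀ z → IsLength ⊥̂ z (ρ z)) →
         ∀ x y → x ≺ y →
         countIn x y (λ z → ρ z % 2 ≡ 0) (λ z → ρ z % 2 ≟ℕ 0)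
           ≡ countIn x y (λ z → ρ z % 2 ≡ 1) (λ z → ρ z % 2 ≟ℕ 1))

  HasRank : ℕ → Set
  HasRank r = IsLength ⊥̂ ⊤̂ r

module Submission where

-- In a graded interval [x, y] let Nᵢ be the number of elements of rank
-- ρ(x) + i (levelSize). Counting the maximal chains of [x, y] by their
-- element of rank i (factor) expresses chain numbers through level sizes,
-- and the Eulerian condition sorted by level (euler-levels) reads
-- N₀ − N₁ + N₂ − ⋯ = 0, where N₀ = N_L = 1. Hence an interval of length 2 is
-- a diamond with 2 maximal chains, and one of length 3 has 2k maximal chains,
-- k ≥ 2 its number of coatoms. In P, counting the D(4) maximal chains by atom,
-- by coatom and by rank-2 element gives D(4) = N₁B(3) = N₃D(3) = 4N₂, while
-- N₁ + N₃ = N₂ + 2 and B(3) = 2k, D(3) = 2q with k, q ≥ 2. Eliminating the Nᵢ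
-- leaves (k − 2)(q − 2)N₂ + 2kq = 4N₂, so (k − 2)(q − 2) < 4, and the few
-- solutions are the nine alternatives (classify).

open import Defs
open import Data.Nat using (ℕ; zero; suc; _+_; _*_; _≤_; z≤n; s≤s; _%_; NonZero; >-nonZero)
open import Data.Nat.Properties
open import Data.Nat.Tactic.RingSolver using (solve)
open import Data.Nat.ListAction using () renaming (sum to listSum)
open import Algebra.Properties.Semiring.Sum +-*-semiring
  using (sum; sum-syntax; sum⁺-syntax; sum-cong-≗; sum-replicate-zero; sum-remove;
         ∑-comm; *-distribˡ-sum; *-distribʳ-sum)
open import Data.Fin using (Fin; zero; suc; toℕ; fromℕ<; punchIn)
open import Data.Fin.Properties using (any?; punchInᵢ≢i; toℕ-injective; toℕ-fromℕ<)
  renaming (_≟_ to _≟ᶠ_)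
open import Data.Fin.Induction using (po-wellFounded; po-noetherian)
open import Data.List using (_∷_; []; map; filter; length; tabulate)
open import Data.Bool using (true; false; if_then_else_)
open import Data.Product using (∃; _×_; _,_; proj₁; proj₂)
open import Data.Sum using (_⊎_; inj₁; inj₂; [_,_]′)
open import Data.Empty using (⊥-elim)
open import Function using (id; _∘_; flip)
open import Induction.WellFounded using (WellFounded; Acc; acc)
open import Relation.Nullary using (¬_; Dec; yes; no; does; contradiction; _×-dec_)
open import Relation.Binary.Structures using (IsPartialOrder)
open import Relation.Binary.PropositionalEquality

𝟙 : {A : Set} → Dec A → ℕ
𝟙 d = if does d then 1 else 0

𝟙-yes : {A : Set} (d : Dec A) → A → 𝟙 d ≡ 1
𝟙-yes (yes _) _ = refl
𝟙-yes (no ¬a) a = contradiction a ¬a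

𝟙-no : {A : Set} (d : Dec A) → ¬ A → 𝟙 d ≡ 0
𝟙-no (yes a) ¬a = contradiction a ¬a
𝟙-no (no _) _ = refl

𝟙-pos : {A : Set} (d : Dec A) → 1 ≤ 𝟙 d → A
𝟙-pos (yes a) _ = a

𝟙-mono : {A B : Set} (a : Dec A) (b : Dec B) → (A → B) → 𝟙 a ≤ 𝟙 b
𝟙-mono (yes a) (yes _) _ = ≤-refl
𝟙-mono (yes a) (no ¬b) f = contradiction (f a) ¬b
𝟙-mono (no _) _ _ = z≤n

𝟙-×ˡ : {A B : Set} (a : Dec A) (b : Dec B) → A → 𝟙 (a ×-dec b) ≡ 𝟙 b
𝟙-×ˡ (yes _) b _ = refl
𝟙-×ˡ (no ¬a) b a = contradiction a ¬a

positive-factors : ∀ m n → 1 ≤ m * n → 1 ≤ m × 1 ≤ n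
positive-factors (suc m) (suc n) _ = s≤s z≤n , s≤s z≤n
positive-factors (suc m) zero p = contradiction (*-zeroʳ (suc m)) (m<n⇒n≢0 p)

unit-factor : ∀ {k m} → 1 ≤ m → m ≡ k * m → k ≡ 1
unit-factor {k} {m} p e = *-cancelʳ-≡ k 1 m {{>-nonZero p}} (trans (sym e) (sym (*-identityˡ m)))

sum-zero : ∀ {n} (f : Fin n → ℕ) → (∀ z → f z ≡ 0) → sum f ≡ 0
sum-zero {n} f f≡0 = trans (sum-cong-≗ f≡0) (sum-replicate-zero n)

sum-single : ∀ {n} (f : Fin n → ℕ) x → (∀ z → z ≢ x → f z ≡ 0) → sum f ≡ f x
sum-single {suc n} f x others = begin
  sum f                                ≡⟨ sum-remove {i = x} f ⟩
  f x + sum (λ j → f (punchIn x j))    ≡⟨ cong (f x +_) (sum-zero _ (λ j → others _ (punchInᵢ≢i x j))) ⟩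
  f x + 0                              ≡⟨ +-identityʳ (f x) ⟩
  f x                                  ∎
  where open ≡-Reasoning

term≤sum : ∀ {n} (f : Fin n → ℕ) x → f x ≤ sum f
term≤sum {suc n} f x = subst (f x ≤_) (sym (sum-remove {i = x} f)) (m≤m+n (f x) _)

sum-mono : ∀ {n} (f g : Fin n → ℕ) → (∀ z → f z ≤ g z) → sum f ≤ sum g
sum-mono {zero} f g f≤g = z≤n
sum-mono {suc n} f g f≤g = +-mono-≤ (f≤g zero) (sum-mono (f ∘ suc) (g ∘ suc) (f≤g ∘ suc))

sum-positive : ∀ {n} (f : Fin n → ℕ) → 1 ≤ sum f → ∃ λ z → 1 ≤ f z
sum-positive f p with any? (λ z → 1 ≤? f z)
... | yes found = found
... | no none = contradiction (sum-zero f (λ z → n<1⇒n≡0 (≰⇒> (λ q → none (z , q))))) (m<n⇒n≢0 p)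

sum-delta : ∀ L j (f : ℕ → ℕ) → j ≤ L → ∑[ i ≤ L ] (f (toℕ i) * 𝟙 (toℕ i ≟ j)) ≡ f j
sum-delta L j f j≤L = begin
  ∑[ i ≤ L ] (f (toℕ i) * 𝟙 (toℕ i ≟ j))  ≡⟨ sum-single _ i₀ off-j ⟩
  f (toℕ i₀) * 𝟙 (toℕ i₀ ≟ j)            ≡⟨ cong (λ m → f m * 𝟙 (m ≟ j)) i₀≡j ⟩
  f j * 𝟙 (j ≟ j)                        ≡⟨ cong (f j *_) (𝟙-yes (j ≟ j) refl) ⟩
  f j * 1                                ≡⟨ *-identityʳ (f j) ⟩
  f j                                    ∎
  where
  open ≡-Reasoning
  i₀ : Fin (suc L)
  i₀ = fromℕ< (s≤s j≤L)
  i₀≡j : toℕ i₀ ≡ j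
  i₀≡j = toℕ-fromℕ< (s≤s j≤L)
  off-j : ∀ i → i ≢ i₀ → f (toℕ i) * 𝟙 (toℕ i ≟ j) ≡ 0
  off-j i i≢i₀ = trans (cong (f (toℕ i) *_) (𝟙-no (toℕ i ≟ j) (λ e → i≢i₀ (toℕ-injective (trans e (sym i₀≡j))))))
                       (*-zeroʳ (f (toℕ i)))

filter-sum : {A : Set} {P : A → Set} (P? : ∀ a → Dec (P a)) (h : A → ℕ) {m : ℕ} (g : Fin m → A) →
  listSum (map h (filter P? (tabulate g))) ≡ ∑[ z < m ] (𝟙 (P? (g z)) * h (g z))
filter-sum P? h {zero} g = refl
filter-sum P? h {suc m} g with does (P? (g zero))
... | true  = cong₂ _+_ (sym (+-identityʳ _)) (filter-sum P? h (g ∘ suc))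
... | false = filter-sum P? h (g ∘ suc)

filter-length : {A : Set} {P : A → Set} (P? : ∀ a → Dec (P a)) {m : ℕ} (g : Fin m → A) →
  length (filter P? (tabulate g)) ≡ ∑[ z < m ] 𝟙 (P? (g z))
filter-length P? {zero} g = refl
filter-length P? {suc m} g with does (P? (g zero))
... | true  = cong suc (filter-length P? (g ∘ suc))
... | false = filter-length P? (g ∘ suc)

parity : ℕ → ℕ → ℕ
parity c m = 𝟙 (m % 2 ≟ c)

parity-suc : ∀ m → parity 0 (suc m) ≡ parity 1 m × parity 1 (suc m) ≡ parity 0 m
parity-suc zero = refl , refl
parity-suc (suc m) = sym (proj₂ (parity-suc m)) , sym (proj₁ (parity-suc m))

parity-offset : ∀ r →
    (∀ i → parity 0 (r + i) ≡ parity 0 i × parity 1 (r + i) ≡ parity 1 i)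
  ⊎ (∀ i → parity 0 (r + i) ≡ parity 1 i × parity 1 (r + i) ≡ parity 0 i)
parity-offset zero = inj₁ (λ i → refl , refl)
parity-offset (suc r) with parity-offset r
... | inj₁ same = inj₂ (λ i → trans (proj₁ (parity-suc (r + i))) (proj₂ (same i)) ,
                              trans (proj₂ (parity-suc (r + i))) (proj₁ (same i)))
... | inj₂ swap = inj₁ (λ i → trans (proj₁ (parity-suc (r + i))) (proj₂ (swap i)) ,
                              trans (proj₂ (parity-suc (r + i))) (proj₁ (swap i)))

Alternating : ℕ → (ℕ → ℕ) → Set
Alternating L N = ∑[ i ≤ L ] (parity 0 (toℕ i) * N (toℕ i)) ≡ ∑[ i ≤ L ] (parity 1 (toℕ i) * N (toℕ i))

alternating-two : ∀ N → N 0 ≡ 1 → N 2 ≡ 1 → Alternating 2 N → N 1 ≡ 2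
alternating-two N = expanded (N 1)
  where
  open ≡-Reasoning
  expanded : ∀ {n₀ n₂} n₁ → n₀ ≡ 1 → n₂ ≡ 1 →
    1 * n₀ + (0 * n₁ + (1 * n₂ + 0)) ≡ 0 * n₀ + (1 * n₁ + (0 * n₂ + 0)) → n₁ ≡ 2
  expanded n₁ refl refl e = begin
    n₁                                     ≡⟨ solve (n₁ ∷ []) ⟩
    0 * 1 + (1 * n₁ + (0 * 1 + 0))         ≡⟨ e ⟨
    2                                      ∎

alternating-four : ∀ N → N 0 ≡ 1 → N 4 ≡ 1 → Alternating 4 N → N 1 + N 3 ≡ N 2 + 2
alternating-four N = expanded (N 1) (N 2) (N 3)
  where
  open ≡-Reasoning
  expanded : ∀ {n₀ n₄} n₁ n₂ n₃ → n₀ ≡ 1 → n₄ ≡ 1 →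
    1 * n₀ + (0 * n₁ + (1 * n₂ + (0 * n₃ + (1 * n₄ + 0))))
      ≡ 0 * n₀ + (1 * n₁ + (0 * n₂ + (1 * n₃ + (0 * n₄ + 0)))) →
    n₁ + n₃ ≡ n₂ + 2
  expanded n₁ n₂ n₃ refl refl e = begin
    n₁ + n₃                                                     ≡⟨ solve (n₁ ∷ n₃ ∷ []) ⟩
    0 * 1 + (1 * n₁ + (0 * n₂ + (1 * n₃ + (0 * 1 + 0))))        ≡⟨ e ⟨
    1 * 1 + (0 * n₁ + (1 * n₂ + (0 * n₃ + (1 * 1 + 0))))        ≡⟨ solve (n₂ ∷ []) ⟩
    n₂ + 2                                                      ∎

module Chains (P : BoundedFinitePoset) where
  open BoundedFinitePoset P

  chains-suc : ∀ k x y → chains (suc k) x y ≡ ∑[ z < n ] (𝟙 (x ⋖? z) * chains k z y)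
  chains-suc k x y = filter-sum (x ⋖?_) (λ z → chains k z y) id

  chains-zero : ∀ x y → chains 0 x y ≡ 𝟙 (x ≟ᶠ y)
  chains-zero x y with x ≟ᶠ y
  ... | yes _ = refl
  ... | no _ = refl

  chains-refl : ∀ x → chains 0 x x ≡ 1
  chains-refl x = trans (chains-zero x x) (𝟙-yes (x ≟ᶠ x) refl)

  chains-zero⇒≡ : ∀ {x y} → 1 ≤ chains 0 x y → x ≡ y
  chains-zero⇒≡ {x} {y} p = 𝟙-pos (x ≟ᶠ y) (subst (1 ≤_) (chains-zero x y) p)

  chains-zero-≢ : ∀ {x y} → x ≢ y → chains 0 x y ≡ 0
  chains-zero-≢ {x} {y} x≢y = trans (chains-zero x y) (𝟙-no (x ≟ᶠ y) x≢y)

  chains-one : ∀ x y → chains 1 x y ≡ 𝟙 (x ⋖? y)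
  chains-one x y = begin
    chains 1 x y                              ≡⟨ chains-suc 0 x y ⟩
    ∑[ z < n ] (𝟙 (x ⋖? z) * chains 0 z y)    ≡⟨ sum-single _ y (λ z z≢y → trans (cong (𝟙 (x ⋖? z) *_) (chains-zero-≢ z≢y)) (*-zeroʳ (𝟙 (x ⋖? z)))) ⟩
    𝟙 (x ⋖? y) * chains 0 y y                 ≡⟨ cong (𝟙 (x ⋖? y) *_) (chains-refl y) ⟩
    𝟙 (x ⋖? y) * 1                            ≡⟨ *-identityʳ _ ⟩
    𝟙 (x ⋖? y)                                ∎
    where open ≡-Reasoning

  compose : ∀ j k x y → chains (j + k) x y ≡ ∑[ z < n ] (chains j x z * chains k z y)
  compose zero k x y = sym (begin
    ∑[ z < n ] (chains 0 x z * chains k z y)   ≡⟨ sum-single _ x (λ z z≢x → cong (_* chains k z y) (chains-zero-≢ (z≢x ∘ sym))) ⟩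
    chains 0 x x * chains k x y                ≡⟨ cong (_* chains k x y) (chains-refl x) ⟩
    1 * chains k x y                           ≡⟨ *-identityˡ _ ⟩
    chains k x y                               ∎)
    where open ≡-Reasoning
  compose (suc j) k x y = begin
    chains (suc (j + k)) x y
      ≡⟨ chains-suc (j + k) x y ⟩
    ∑[ w < n ] (𝟙 (x ⋖? w) * chains (j + k) w y)
      ≡⟨ sum-cong-≗ (λ w → cong (𝟙 (x ⋖? w) *_) (compose j k w y)) ⟩
    ∑[ w < n ] (𝟙 (x ⋖? w) * ∑[ z < n ] (chains j w z * chains k z y))
      ≡⟨ sum-cong-≗ (λ w → *-distribˡ-sum (𝟙 (x ⋖? w)) (λ z → chains j w z * chains k z y)) ⟩
    ∑[ w < n ] ∑[ z < n ] (𝟙 (x ⋖? w) * (chains j w z * chains k z y))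
      ≡⟨ ∑-comm (λ w z → 𝟙 (x ⋖? w) * (chains j w z * chains k z y)) ⟩
    ∑[ z < n ] ∑[ w < n ] (𝟙 (x ⋖? w) * (chains j w z * chains k z y))
      ≡⟨ sum-cong-≗ (λ z → sum-cong-≗ (λ w → sym (*-assoc (𝟙 (x ⋖? w)) (chains j w z) (chains k z y)))) ⟩
    ∑[ z < n ] ∑[ w < n ] (𝟙 (x ⋖? w) * chains j w z * chains k z y)
      ≡⟨ sum-cong-≗ (λ z → sym (*-distribʳ-sum (chains k z y) (λ w → 𝟙 (x ⋖? w) * chains j w z))) ⟩
    ∑[ z < n ] (∑[ w < n ] (𝟙 (x ⋖? w) * chains j w z) * chains k z y)
      ≡⟨ sum-cong-≗ (λ z → cong (_* chains k z y) (sym (chains-suc j x z))) ⟩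
    ∑[ z < n ] (chains (suc j) x z * chains k z y)
      ∎
    where open ≡-Reasoning

  chains-≼ : ∀ k {x y} → 1 ≤ chains k x y → x ≼ y
  chains-≼ zero p with chains-zero⇒≡ p
  ... | refl = ≼-refl _
  chains-≼ (suc k) {x} {y} p with sum-positive _ (subst (1 ≤_) (chains-suc k x y) p)
  ... | z , q with positive-factors (𝟙 (x ⋖? z)) (chains k z y) q
  ... | x⋖z , z→y = ≼-trans (proj₁ (proj₁ (𝟙-pos (x ⋖? z) x⋖z))) (chains-≼ k z→y)

  chains-step : ∀ {x z} k y → x ⋖ z → chains k z y ≤ chains (suc k) x y
  chains-step {x} {z} k y x⋖z = begin
    chains k z y                               ≡⟨ *-identityˡ _ ⟨
    1 * chains k z y                           ≡⟨ cong (_* chains k z y) (𝟙-yes (x ⋖? z) x⋖z) ⟨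
    𝟙 (x ⋖? z) * chains k z y                  ≤⟨ term≤sum (λ w → 𝟙 (x ⋖? w) * chains k w y) z ⟩
    ∑[ w < n ] (𝟙 (x ⋖? w) * chains k w y)     ≡⟨ chains-suc k x y ⟨
    chains (suc k) x y                         ∎
    where open ≤-Reasoning

  ≼-isPartialOrder : IsPartialOrder _≡_ _≼_
  ≼-isPartialOrder = record
    { isPreorder = record
      { isEquivalence = isEquivalence
      ; reflexive = λ { refl → ≼-refl _ }
      ; trans = ≼-trans
      }
    ; antisym = ≼-antisym
    }

  ≺-wellFounded : WellFounded _≺_
  ≺-wellFounded = po-wellFounded ≼-isPartialOrder

  ≻-wellFounded : WellFounded (flip _≺_)
  ≻-wellFounded = po-noetherian ≼-isPartialOrder

  cover-below : ∀ {x y} → Acc _≺_ y → x ≺ y → ∃ λ z → x ⋖ z × z ≼ y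
  cover-below {x} {y} (acc below) x≺y with any? (λ w → (x ≺? w) ×-dec (w ≺? y))
  ... | no nothing-between = y , (x≺y , nothing-between) , ≼-refl y
  ... | yes (w , x≺w , w≺y) with cover-below (below w≺y) x≺w
  ...   | z , x⋖z , z≼w = z , x⋖z , ≼-trans z≼w (proj₁ w≺y)

  chain-exists : ∀ {x y} → Acc (flip _≺_) x → x ≼ y → ∃ λ k → 1 ≤ chains k x y
  chain-exists {x} {y} (acc above) x≼y with x ≟ᶠ y
  ... | yes refl = 0 , ≤-reflexive (sym (chains-refl x))
  ... | no x≢y with cover-below (≺-wellFounded y) (x≼y , x≢y)
  ...   | z , x⋖z , z≼y with chain-exists (above (proj₁ x⋖z)) z≼y
  ...     | k , p = suc k , ≤-trans p (chains-step k y x⋖z)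

  length-unique : ∀ {x y j k} → IsLength x y k → 1 ≤ chains j x y → j ≡ k
  length-unique {j = j} {k} (_ , others) p with j ≟ k
  ... | yes j≡k = j≡k
  ... | no j≢k = contradiction (others j j≢k) (m<n⇒n≢0 p)

  length-pos : ∀ {x y k} → IsLength x y k → 1 ≤ chains k x y
  length-pos {x} {y} l with chain-exists (≻-wellFounded x) (proj₁ l)
  ... | j , p = subst (λ i → 1 ≤ chains i x y) (length-unique {j = j} l p) p

  length-zero : ∀ {x y} → IsLength x y 0 → x ≡ y
  length-zero l = chains-zero⇒≡ (length-pos l)

  length-suc⇒≢ : ∀ {x y i} → IsLength x y (suc i) → x ≢ y
  length-suc⇒≢ {x} (_ , others) refl with trans (sym (chains-refl x)) (others 0 (λ ()))
  ... | ()

  length-one : ∀ {x y} → IsLength x y 1 → chains 1 x y ≡ 1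
  length-one {x} {y} l = trans (chains-one x y) (𝟙-yes (x ⋖? y) x⋖y)
    where
    x⋖y : x ⋖ y
    x⋖y = 𝟙-pos (x ⋖? y) (subst (1 ≤_) (chains-one x y) (length-pos l))

IsGraded : BoundedFinitePoset → Set
IsGraded P = ∀ x y → x ≼ y → ∃ λ k → IsLength x y k
  where open BoundedFinitePoset P

module Graded (P : BoundedFinitePoset) (graded : IsGraded P) where
  open BoundedFinitePoset P
  open Chains P public

  positive⇒length : ∀ {j x y} → 1 ≤ chains j x y → IsLength x y j
  positive⇒length {j} {x} {y} p with graded x y (chains-≼ j p)
  ... | k , l = subst (IsLength x y) (sym (length-unique {j = j} l p)) l

  length-add : ∀ {x w y a b c} → IsLength x w a → IsLength w y b → IsLength x y c → a + b ≡ c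
  length-add {x} {w} {y} {a} {b} lxw lwy lxy = length-unique {j = a + b} lxy (begin
    1                                           ≤⟨ *-mono-≤ (length-pos lxw) (length-pos lwy) ⟩
    chains a x w * chains b w y                 ≤⟨ term≤sum (λ z → chains a x z * chains b z y) w ⟩
    ∑[ z < n ] (chains a x z * chains b z y)    ≡⟨ compose a b x y ⟨
    chains (a + b) x y                          ∎)
    where open ≤-Reasoning

  positive-term⇒lengths : ∀ i j {x y z} → 1 ≤ chains i x z * chains j z y → IsLength x z i × IsLength z y j
  positive-term⇒lengths i j {x} {y} {z} p with positive-factors (chains i x z) (chains j z y) p
  ... | p₁ , p₂ = positive⇒length p₁ , positive⇒length p₂

  split : ∀ {i j x y} → IsLength x y (i + j) → ∃ λ z → IsLength x z i × IsLength z y j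
  split {i} {j} {x} {y} l with sum-positive _ (subst (1 ≤_) (compose i j x y) (length-pos l))
  ... | z , p = z , positive-term⇒lengths i j p

module Ranked (P : BoundedFinitePoset)
  (graded : IsGraded P)
  (ρ : Fin (BoundedFinitePoset.n P) → ℕ)
  (ρ-ok : ∀ z → BoundedFinitePoset.IsLength P (BoundedFinitePoset.⊥̂ P) z (ρ z)) where
  open BoundedFinitePoset P
  open Graded P graded public

  rank-step : ∀ {x z j} → IsLength x z j → ρ z ≡ ρ x + j
  rank-step {x} {z} l = sym (length-add (ρ-ok x) l (ρ-ok z))

  AtLevel : Fin n → Fin n → ℕ → Fin n → Set
  AtLevel x y i z = (x ≼ z × z ≼ y) × ρ z ≡ ρ x + i

  at-level? : ∀ x y i z → Dec (AtLevel x y i z)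
  at-level? x y i z = ((x ≼? z) ×-dec (z ≼? y)) ×-dec (ρ z ≟ ρ x + i)

  levelSize : Fin n → Fin n → ℕ → ℕ
  levelSize x y i = ∑[ z < n ] 𝟙 (at-level? x y i z)

  level⇒lengths : ∀ {i j x y z} → IsLength x y (i + j) → AtLevel x y i z → IsLength x z i × IsLength z y j
  level⇒lengths {i} {j} {x} {y} {z} l ((x≼z , z≼y) , ρz) with graded x z x≼z | graded z y z≼y
  ... | a , lxz | b , lzy with +-cancelˡ-≡ (ρ x) a i (trans (sym (rank-step lxz)) ρz)
  ...   | refl with +-cancelˡ-≡ a b j (length-add lxz lzy l)
  ...     | refl = lxz , lzy

  lengths⇒level : ∀ {i j x y z} → IsLength x z i → IsLength z y j → AtLevel x y i z
  lengths⇒level lxz lzy = (proj₁ lxz , proj₁ lzy) , rank-step lxz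

  factor : ∀ {i j L x y} V → i + j ≡ L → IsLength x y L →
    (∀ z → IsLength x z i → IsLength z y j → chains i x z * chains j z y ≡ V) →
    chains L x y ≡ levelSize x y i * V
  factor {i} {j} {_} {x} {y} V refl l through = begin
    chains (i + j) x y                              ≡⟨ compose i j x y ⟩
    ∑[ z < n ] (chains i x z * chains j z y)        ≡⟨ sum-cong-≗ term ⟩
    ∑[ z < n ] (𝟙 (at-level? x y i z) * V)          ≡⟨ *-distribʳ-sum V (λ z → 𝟙 (at-level? x y i z)) ⟨
    levelSize x y i * V                             ∎
    where
    open ≡-Reasoning
    term : ∀ z → chains i x z * chains j z y ≡ 𝟙 (at-level? x y i z) * V
    term z with at-level? x y i z
    ... | yes at = let (lxz , lzy) = level⇒lengths l at in begin
      chains i x z * chains j z y   ≡⟨ through z lxz lzy ⟩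
      V                             ≡⟨ *-identityˡ V ⟨
      1 * V                         ≡⟨ cong (_* V) (𝟙-yes (at-level? x y i z) at) ⟨
      𝟙 (at-level? x y i z) * V     ∎
    ... | no ¬at = trans (n<1⇒n≡0 (≰⇒> (¬at ∘ passes))) (sym (cong (_* V) (𝟙-no (at-level? x y i z) ¬at)))
      where
      passes : 1 ≤ chains i x z * chains j z y → AtLevel x y i z
      passes p = let (lxz , lzy) = positive-term⇒lengths i j p in lengths⇒level lxz lzy

  level-bottom : ∀ {x y L} → IsLength x y L → levelSize x y 0 ≡ 1
  level-bottom {x} {y} {L} l = unit-factor (length-pos l) (factor (chains L x y) refl l through)
    where
    through : ∀ z → IsLength x z 0 → IsLength z y L → chains 0 x z * chains L z y ≡ chains L x y
    through z lxz _ with length-zero lxz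
    ... | refl = trans (cong (_* chains L x y) (chains-refl x)) (*-identityˡ _)

  level-top : ∀ {x y L} → IsLength x y L → levelSize x y L ≡ 1
  level-top {x} {y} {L} l = unit-factor (length-pos l) (factor (chains L x y) (+-identityʳ L) l through)
    where
    through : ∀ z → IsLength x z L → IsLength z y 0 → chains L x z * chains 0 z y ≡ chains L x y
    through z _ lzy with length-zero lzy
    ... | refl = trans (cong (chains L x y *_) (chains-refl y)) (*-identityʳ _)

  level-shift : ∀ {x w y a} i → IsLength x w a → levelSize w y i ≤ levelSize x y (a + i)
  level-shift {x} {w} {y} {a} i lxw = sum-mono _ _ (λ z → 𝟙-mono (at-level? w y i z) (at-level? x y (a + i) z) lift)
    where
    lift : ∀ {z} → AtLevel w y i z → AtLevel x y (a + i) z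
    lift ((w≼z , z≼y) , ρz) =
      (≼-trans (proj₁ lxw) w≼z , z≼y) , trans ρz (trans (cong (_+ i) (rank-step lxw)) (+-assoc (ρ x) a i))

  level-indicator : ∀ {x y z j} → x ≼ z → z ≼ y → ρ z ≡ ρ x + j → ∀ i → 𝟙 (at-level? x y i z) ≡ 𝟙 (i ≟ j)
  level-indicator {x} {y} {z} {j} x≼z z≼y ρz i with i ≟ j
  ... | yes refl = trans (𝟙-yes (at-level? x y i z) ((x≼z , z≼y) , ρz)) (sym (𝟙-yes (i ≟ i) refl))
  ... | no i≢j = trans (𝟙-no (at-level? x y i z) (λ at → i≢j (+-cancelˡ-≡ (ρ x) i j (trans (sym (proj₂ at)) ρz))))
                       (sym (𝟙-no (i ≟ j) i≢j))

  indicator-by-level : ∀ {L x y} {Q : ℕ → Set} (Q? : ∀ m → Dec (Q m)) → IsLength x y L → ∀ z →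
    𝟙 (((x ≼? z) ×-dec (z ≼? y)) ×-dec Q? (ρ z))
      ≡ ∑[ i ≤ L ] (𝟙 (Q? (ρ x + toℕ i)) * 𝟙 (at-level? x y (toℕ i) z))
  indicator-by-level {L} {x} {y} Q? l z with (x ≼? z) ×-dec (z ≼? y)
  ... | no z∉ = trans (𝟙-no (((x ≼? z) ×-dec (z ≼? y)) ×-dec Q? (ρ z)) (z∉ ∘ proj₁))
                 (sym (sum-zero {suc L} (λ i → 𝟙 (Q? (ρ x + toℕ i)) * 𝟙 (at-level? x y (toℕ i) z))
                   (λ i → trans (cong (𝟙 (Q? (ρ x + toℕ i)) *_) (𝟙-no (at-level? x y (toℕ i) z) (z∉ ∘ proj₁)))
                                (*-zeroʳ (𝟙 (Q? (ρ x + toℕ i)))))))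
  ... | yes (x≼z , z≼y) with graded x z x≼z | graded z y z≼y
  ...   | j , lxz | j′ , lzy = begin
    𝟙 (((x ≼? z) ×-dec (z ≼? y)) ×-dec Q? (ρ z))                      ≡⟨ 𝟙-×ˡ ((x ≼? z) ×-dec (z ≼? y)) (Q? (ρ z)) (x≼z , z≼y) ⟩
    𝟙 (Q? (ρ z))                                                      ≡⟨ cong (λ m → 𝟙 (Q? m)) (rank-step lxz) ⟩
    𝟙 (Q? (ρ x + j))                                                  ≡⟨ sum-delta L j (λ m → 𝟙 (Q? (ρ x + m))) j≤L ⟨
    ∑[ i ≤ L ] (𝟙 (Q? (ρ x + toℕ i)) * 𝟙 (toℕ i ≟ j))                 ≡⟨ sum-cong-≗ delta ⟨
    ∑[ i ≤ L ] (𝟙 (Q? (ρ x + toℕ i)) * 𝟙 (at-level? x y (toℕ i) z))   ∎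
    where
    open ≡-Reasoning
    j≤L : j ≤ L
    j≤L = subst (j ≤_) (length-add lxz lzy l) (m≤m+n j j′)
    delta : ∀ (i : Fin (suc L)) → 𝟙 (Q? (ρ x + toℕ i)) * 𝟙 (at-level? x y (toℕ i) z) ≡ 𝟙 (Q? (ρ x + toℕ i)) * 𝟙 (toℕ i ≟ j)
    delta i = cong (𝟙 (Q? (ρ x + toℕ i)) *_) (level-indicator x≼z z≼y (rank-step lxz) (toℕ i))

  count-by-level : ∀ {L x y} {Q : ℕ → Set} (Q? : ∀ m → Dec (Q m)) → IsLength x y L →
    countIn x y (λ z → Q (ρ z)) (λ z → Q? (ρ z)) ≡ ∑[ i ≤ L ] (𝟙 (Q? (ρ x + toℕ i)) * levelSize x y (toℕ i))
  count-by-level {L} {x} {y} Q? l = begin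
    countIn x y _ (λ z → Q? (ρ z))
      ≡⟨ filter-length (λ z → ((x ≼? z) ×-dec (z ≼? y)) ×-dec Q? (ρ z)) id ⟩
    ∑[ z < n ] 𝟙 (((x ≼? z) ×-dec (z ≼? y)) ×-dec Q? (ρ z))
      ≡⟨ sum-cong-≗ (indicator-by-level Q? l) ⟩
    ∑[ z < n ] ∑[ i ≤ L ] (𝟙 (Q? (ρ x + toℕ i)) * 𝟙 (at-level? x y (toℕ i) z))
      ≡⟨ ∑-comm {n} {suc L} (λ z i → 𝟙 (Q? (ρ x + toℕ i)) * 𝟙 (at-level? x y (toℕ i) z)) ⟩
    ∑[ i ≤ L ] ∑[ z < n ] (𝟙 (Q? (ρ x + toℕ i)) * 𝟙 (at-level? x y (toℕ i) z))
      ≡⟨ sum-cong-≗ {suc L} (λ i → *-distribˡ-sum (𝟙 (Q? (ρ x + toℕ i))) (λ z → 𝟙 (at-level? x y (toℕ i) z))) ⟨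
    ∑[ i ≤ L ] (𝟙 (Q? (ρ x + toℕ i)) * levelSize x y (toℕ i))
      ∎
    where open ≡-Reasoning

module Eulerian (P : BoundedFinitePoset)
  (graded : IsGraded P)
  (eulerian : BoundedFinitePoset.IsEulerian P) where
  open BoundedFinitePoset P

  ρ : Fin n → ℕ
  ρ z = proj₁ (proj₁ eulerian z)

  ρ-ok : ∀ z → IsLength ⊥̂ z (ρ z)
  ρ-ok z = proj₂ (proj₁ eulerian z)

  open Ranked P graded ρ ρ-ok public

  euler-levels : ∀ {L x y} → IsLength x y (suc L) → Alternating (suc L) (levelSize x y)
  euler-levels {L} {x} {y} l =
    [ (λ same → trans (sym (reindex (proj₁ ∘ same))) (trans balanced (reindex (proj₂ ∘ same))))
    , (λ swap → trans (sym (reindex (proj₂ ∘ swap))) (trans (sym balanced) (reindex (proj₁ ∘ swap))))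
    ]′ (parity-offset (ρ x))
    where
    weighted : (ℕ → ℕ) → ℕ
    weighted w = ∑[ i ≤ suc L ] (w (toℕ i) * levelSize x y (toℕ i))
    reindex : ∀ {w w′} → (∀ i → w i ≡ w′ i) → weighted w ≡ weighted w′
    reindex w≡w′ = sum-cong-≗ {suc (suc L)} (λ i → cong (_* levelSize x y (toℕ i)) (w≡w′ (toℕ i)))
    balanced : weighted (λ i → parity 0 (ρ x + i)) ≡ weighted (λ i → parity 1 (ρ x + i))
    balanced = trans (sym (count-by-level (λ m → m % 2 ≟ 0) l))
                 (trans (proj₂ eulerian ρ ρ-ok x y (proj₁ l , length-suc⇒≢ l)) (count-by-level (λ m → m % 2 ≟ 1) l))

  diamond : ∀ {x y} → IsLength x y 2 → levelSize x y 1 ≡ 2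
  diamond {x} {y} l = alternating-two (levelSize x y) (level-bottom l) (level-top l) (euler-levels l)

  chains-two : ∀ {x y} → IsLength x y 2 → chains 2 x y ≡ 2
  chains-two {x} {y} l = trans (factor {i = 1} {j = 1} 1 refl l (λ z lxz lzy → cong₂ _*_ (length-one lxz) (length-one lzy)))
                               (cong (_* 1) (diamond l))

  -- An interval of length 3 has 2·N maximal chains, N the number of its
  -- coatoms (each coatom z closes the two chains of [x, z]) …
  chains-three : ∀ {x y} → IsLength x y 3 → chains 3 x y ≡ 2 * levelSize x y 2
  chains-three {x} {y} l = trans (factor {i = 2} {j = 1} 2 refl l (λ z lxz lzy → cong₂ _*_ (chains-two lxz) (length-one lzy)))
                                 (*-comm (levelSize x y 2) 2)

  -- … and at least two coatoms, the atoms of [w, y] for any atom w.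
  coatoms-of-three : ∀ {x y} → IsLength x y 3 → 2 ≤ levelSize x y 2
  coatoms-of-three {x} {y} l = let (w , xw , wy) = split {1} {2} l in begin
    2                   ≡⟨ diamond wy ⟨
    levelSize w y 1     ≤⟨ level-shift 1 xw ⟩
    levelSize x y 2     ∎
    where open ≤-Reasoning

  euler-four : ∀ {x y} → IsLength x y 4 → levelSize x y 1 + levelSize x y 3 ≡ levelSize x y 2 + 2
  euler-four {x} {y} l = alternating-four (levelSize x y) (level-bottom l) (level-top l) (euler-levels l)

module EulerianSheffer (P : BoundedFinitePoset) (B D : ℕ → ℕ)
  (sheffer : BoundedFinitePoset.IsSheffer P B D)
  (eulerian : BoundedFinitePoset.IsEulerian P) where
  open BoundedFinitePoset P
  open Eulerian P (proj₁ sheffer) eulerian public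

  D-chains : ∀ y k → IsLength ⊥̂ y k → chains k ⊥̂ y ≡ D k
  D-chains = proj₁ (proj₂ sheffer)

  B-chains : ∀ x y k → x ≢ ⊥̂ → IsLength x y k → chains k x y ≡ B k
  B-chains = proj₂ (proj₂ sheffer)

  -- The upper and lower intervals of length 3 given by an atom, resp. a
  -- coatom, show that B(3) and D(3) are even with half at least 2.
  B-three : ∀ {y} → IsLength ⊥̂ y 4 → ∃ λ k → 2 ≤ k × B 3 ≡ 2 * k
  B-three {y} l = let (a , ⊥a , ay) = split {1} {3} l in
    levelSize a y 2 , coatoms-of-three ay , trans (sym (B-chains a y 3 (length-suc⇒≢ ⊥a ∘ sym) ay)) (chains-three ay)

  D-three : ∀ {y} → IsLength ⊥̂ y 4 → ∃ λ q → 2 ≤ q × D 3 ≡ 2 * q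
  D-three {y} l = let (c , ⊥c , _) = split {3} {1} l in
    levelSize ⊥̂ c 2 , coatoms-of-three ⊥c , trans (sym (D-chains c 3 ⊥c)) (chains-three ⊥c)

  chains-by-atoms : ∀ {y} → IsLength ⊥̂ y 4 → D 4 ≡ levelSize ⊥̂ y 1 * B 3
  chains-by-atoms {y} l = trans (sym (D-chains y 4 l)) (factor {i = 1} {j = 3} (B 3) refl l
    (λ z l₁ l₃ → trans (cong₂ _*_ (length-one l₁) (B-chains z y 3 (length-suc⇒≢ l₁ ∘ sym) l₃)) (*-identityˡ (B 3))))

  chains-by-coatoms : ∀ {y} → IsLength ⊥̂ y 4 → D 4 ≡ levelSize ⊥̂ y 3 * D 3
  chains-by-coatoms {y} l = trans (sym (D-chains y 4 l)) (factor {i = 3} {j = 1} (D 3) refl l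
    (λ z l₃ l₁ → trans (cong₂ _*_ (D-chains z 3 l₃) (length-one l₁)) (*-identityʳ (D 3))))

  chains-by-rank-two : ∀ {y} → IsLength ⊥̂ y 4 → D 4 ≡ levelSize ⊥̂ y 2 * 4
  chains-by-rank-two {y} l = trans (sym (D-chains y 4 l)) (factor {i = 2} {j = 2} 4 refl l
    (λ z l₂ l₂′ → cong₂ _*_ (chains-two l₂) (chains-two l₂′)))

RankFourCases : ℕ → ℕ → ℕ → Set
RankFourCases b₃ d₃ d₄ =
      (∃ λ r → 2 ≤ r × b₃ ≡ 2 * r × d₃ ≡ 4 × d₄ ≡ 4 * r)
    ⊎ (b₃ ≡ 10 × d₃ ≡ 6 × d₄ ≡ 120)
    ⊎ (b₃ ≡ 8 × d₃ ≡ 6 × d₄ ≡ 48)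
    ⊎ (b₃ ≡ 6 × d₃ ≡ 6 × d₄ ≡ 24)
    ⊎ (b₃ ≡ 4 × d₃ ≡ 6 × d₄ ≡ 12)
    ⊎ (b₃ ≡ 6 × d₃ ≡ 10 × d₄ ≡ 120)
    ⊎ (b₃ ≡ 6 × d₃ ≡ 8 × d₄ ≡ 48)
    ⊎ (b₃ ≡ 6 × d₃ ≡ 4 × d₄ ≡ 12)
    ⊎ (∃ λ r → 2 ≤ r × b₃ ≡ 4 × d₃ ≡ 2 * r × d₄ ≡ 4 * r)

-- Writing B(3) = 2k, D(3) = 2q with k = 2 + K, q = 2 + Q and b for the
-- number of rank-2 elements, the counting relations collapse to
--   K·Q·b + 2kq = 4b.
-- Since 2kq > 0 this forces K·Q < 4, leaving finitely many cases.
rank-four-equation : ∀ a b c K Q → a * (2 + K) ≡ 2 * b → c * (2 + Q) ≡ 2 * b →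
  a + c ≡ b + 2 → K * Q * b + 2 * ((2 + K) * (2 + Q)) ≡ 4 * b
rank-four-equation a b c K Q ak cq ac = sym (+-cancelˡ-≡ (2 * b * (K + Q) + 4 * b) _ _ (begin
    (2 * b * (K + Q) + 4 * b) + 4 * b             ≡⟨ solve (b ∷ K ∷ Q ∷ []) ⟩
    2 * b * (2 + K) + 2 * b * (2 + Q)             ≡⟨ cong₂ _+_ (cong (_* (2 + K)) (sym cq)) (cong (_* (2 + Q)) (sym ak)) ⟩
    c * (2 + Q) * (2 + K) + a * (2 + K) * (2 + Q) ≡⟨ solve (a ∷ c ∷ K ∷ Q ∷ []) ⟩
    (a + c) * ((2 + K) * (2 + Q))                 ≡⟨ cong (_* ((2 + K) * (2 + Q))) ac ⟩
    (b + 2) * ((2 + K) * (2 + Q))                 ≡⟨ solve (b ∷ K ∷ Q ∷ []) ⟩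
    (2 * b * (K + Q) + 4 * b) + (K * Q * b + 2 * ((2 + K) * (2 + Q))) ∎))
  where open ≡-Reasoning

rank-four-bound : ∀ K Q b → 4 ≤ K * Q → K * Q * b + 2 * ((2 + K) * (2 + Q)) ≢ 4 * b
rank-four-bound K Q b 4≤KQ e = <-irrefl (sym e) (begin-strict
    4 * b                                    ≤⟨ *-monoˡ-≤ b 4≤KQ ⟩
    K * Q * b                                <⟨ m<m+n (K * Q * b) (s≤s z≤n) ⟩
    K * Q * b + 2 * ((2 + K) * (2 + Q))      ∎)
  where open ≤-Reasoning

solve-for : ∀ m t s v b → .{{_ : NonZero t}} → m * b + s ≡ (m + t) * b → t * v ≡ s → b ≡ v
solve-for m t s v b e tv = *-cancelˡ-≡ b v t (trans tb≡s (sym tv))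
  where
  tb≡s : t * b ≡ s
  tb≡s = sym (+-cancelˡ-≡ (m * b) s (t * b) (trans e (*-distribʳ-+ b m t)))

rank-four-solutions : ∀ K Q b → K * Q * b + 2 * ((2 + K) * (2 + Q)) ≡ 4 * b →
  RankFourCases (2 * (2 + K)) (2 * (2 + Q)) (4 * b)
rank-four-solutions zero Q b e =
  inj₂ (inj₂ (inj₂ (inj₂ (inj₂ (inj₂ (inj₂ (inj₂ (2 + Q , m≤m+n 2 Q , refl , refl , cong (4 *_) b≡q))))))))
  where
  b≡q : b ≡ 2 + Q
  b≡q = *-cancelˡ-≡ b (2 + Q) 4 (trans (sym e) (solve (Q ∷ [])))
rank-four-solutions (suc K) zero b e = inj₁ (3 + K , m≤m+n 2 (suc K) , refl , refl , cong (4 *_) b≡k)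
  where
  b≡k : b ≡ 3 + K
  b≡k = *-cancelˡ-≡ b (3 + K) 4 (trans (sym e) (solve (K ∷ b ∷ [])))
rank-four-solutions 1 1 b e = inj₂ (inj₂ (inj₂ (inj₁ (refl , refl , cong (4 *_) (solve-for 1 3 18 6 b e refl)))))
rank-four-solutions 1 2 b e = inj₂ (inj₂ (inj₂ (inj₂ (inj₂ (inj₂ (inj₁ (refl , refl , cong (4 *_) (solve-for 2 2 24 12 b e refl))))))))
rank-four-solutions 1 3 b e = inj₂ (inj₂ (inj₂ (inj₂ (inj₂ (inj₁ (refl , refl , cong (4 *_) (solve-for 3 1 30 30 b e refl)))))))
rank-four-solutions 2 1 b e = inj₂ (inj₂ (inj₁ (refl , refl , cong (4 *_) (solve-for 2 2 24 12 b e refl))))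
rank-four-solutions 3 1 b e = inj₂ (inj₁ (refl , refl , cong (4 *_) (solve-for 3 1 30 30 b e refl)))
rank-four-solutions 1 (suc (suc (suc (suc Q)))) b e =
  ⊥-elim (rank-four-bound 1 (4 + Q) b (s≤s (s≤s (s≤s (s≤s z≤n)))) e)
rank-four-solutions (suc (suc (suc (suc K)))) 1 b e =
  ⊥-elim (rank-four-bound (4 + K) 1 b (s≤s (s≤s (s≤s (s≤s z≤n)))) e)
rank-four-solutions (suc (suc K)) (suc (suc Q)) b e =
  ⊥-elim (rank-four-bound (2 + K) (2 + Q) b (*-mono-≤ {2} {2 + K} {2} {2 + Q} (m≤m+n 2 K) (m≤m+n 2 Q)) e)

halve : ∀ a k b → a * (2 * k) ≡ b * 4 → a * k ≡ 2 * b
halve a k b e = *-cancelˡ-≡ (a * k) (2 * b) 2 (begin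
  2 * (a * k)  ≡⟨ solve (a ∷ k ∷ []) ⟩
  a * (2 * k)  ≡⟨ e ⟩
  b * 4        ≡⟨ solve (b ∷ []) ⟩
  2 * (2 * b)  ∎)
  where open ≡-Reasoning

classify : ∀ {a b c b₃ d₃ d₄} → (∃ λ k → 2 ≤ k × b₃ ≡ 2 * k) → (∃ λ q → 2 ≤ q × d₃ ≡ 2 * q) →
  d₄ ≡ a * b₃ → d₄ ≡ c * d₃ → d₄ ≡ b * 4 → a + c ≡ b + 2 → RankFourCases b₃ d₃ d₄
classify {a} {b} {c} (suc (suc K) , s≤s (s≤s _) , refl) (suc (suc Q) , s≤s (s≤s _) , refl) e₁ e₂ refl ac =
  subst (RankFourCases _ _) (*-comm 4 b)
    (rank-four-solutions K Q b
      (rank-four-equation a b c K Q (halve a (2 + K) b (sym e₁)) (halve c (2 + Q) b (sym e₂)) ac))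

lemma4p4 : (P : BoundedFinitePoset) (B D : ℕ → ℕ) →
    BoundedFinitePoset.IsSheffer P B D →
    BoundedFinitePoset.IsEulerian P →
    BoundedFinitePoset.HasRank P 4 →
      (∃ λ r → 2 ≤ r × B 3 ≡ 2 * r × D 3 ≡ 4 × D 4 ≡ 4 * r)
    ⊎ (B 3 ≡ 10 × D 3 ≡ 6 × D 4 ≡ 120)
    ⊎ (B 3 ≡ 8 × D 3 ≡ 6 × D 4 ≡ 48)
    ⊎ (B 3 ≡ 6 × D 3 ≡ 6 × D 4 ≡ 24)
    ⊎ (B 3 ≡ 4 × D 3 ≡ 6 × D 4 ≡ 12)
    ⊎ (B 3 ≡ 6 × D 3 ≡ 10 × D 4 ≡ 120)
    ⊎ (B 3 ≡ 6 × D 3 ≡ 8 × D 4 ≡ 48)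
    ⊎ (B 3 ≡ 6 × D 3 ≡ 4 × D 4 ≡ 12)
    ⊎ (∃ λ r → 2 ≤ r × B 3 ≡ 4 × D 3 ≡ 2 * r × D 4 ≡ 4 * r)
lemma4p4 P B D sheffer eulerian rank-four =
  classify {a = levelSize ⊥̂ ⊤̂ 1} {levelSize ⊥̂ ⊤̂ 2} {levelSize ⊥̂ ⊤̂ 3}
    (B-three rank-four) (D-three rank-four)
    (chains-by-atoms rank-four) (chains-by-coatoms rank-four) (chains-by-rank-two rank-four)
    (euler-four rank-four)
  where
  open BoundedFinitePoset P
  open EulerianSheffer P B D sheffer eulerian
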